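{- Let $\Gamma$ be a strictly Deza graph with parameters $(n,k,b,a)$ such that $k=b+1$ and $\beta(\Gamma)>1$. For every vertex $x$ of type (A) and every $x_i\in B(x)$, we have $B[x]=B[x_i]$ and $N(x_i)\cap B(x_i)=\emptyset$; in particular every vertex of $B(x)$ is of type (A).
   Context: Graphs are finite, simple, undirected. $N(v)$ is the neighbourhood of $v$. A Deza graph with parameters $(n,k,b,a)$, $b\ge a$, is a nonempty $k$-regular graph on $n$ vertices in which every pair of distinct vertices has exactly $b$ or exactly $a$ common neighbours; it is strictly Deza if it has diameter $2$ and is not strongly regular. $B(v)=\{u: |N(u)\cap N(v)|=b\}$, $B[v]=B(v)\cup\{v\}$; $\beta(\Gamma)=|B(v)|$ (independent of $v$). A vertex $v$ is of type (A) if $B(v)\cap N(v)=\emptyset$. -}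

module Defs where

open import Data.Nat using (ℕ; _≤_; _<_; _≥_)
open import Data.Fin using (Fin)
open import Data.Bool using (Bool; true; false; _∧_)
open import Data.List using (length; filter; allFin)
open import Data.Product using (_×_; ∃; ∃-syntax; Σ-syntax)
open import Data.Sum using (_⊎_)
open import Relation.Nullary using (¬_)
open import Relation.Binary.PropositionalEquality using (_≡_; _≢_)
open import Function using (_⇔_)

record Graph (n : ℕ) : Set where
  field
    adj   : Fin n → Fin n → Bool
    sym   : ∀ u v → adj u v ≡ adj v u
    irref : ∀ v → adj v v ≡ false
open Graph public

Adj : ∀ {n} → Graph n → Fin n → Fin n → Set
Adj G u v = adj G u v ≡ true

degree : ∀ {n} → Graph n → Fin n → ℕ
degree {n} G v = length (filter (λ w → adj G v w Data.Bool.≟ true) (allFin n))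

common : ∀ {n} → Graph n → Fin n → Fin n → ℕ
common {n} G u v = length (filter (λ w → (adj G u w ∧ adj G v w) Data.Bool.≟ true) (allFin n))

Regular : ∀ {n} → Graph n → ℕ → Set
Regular G k = ∀ v → degree G v ≡ k

IsDeza : ∀ {n} → Graph n → ℕ → ℕ → ℕ → Set
IsDeza {n} G k b a =
  (1 ≤ n) × (b ≥ a) × Regular G k ×
  (∀ u v → u ≢ v → (common G u v ≡ b) ⊎ (common G u v ≡ a))

HasDiameter2 : ∀ {n} → Graph n → Set
HasDiameter2 G =
  (∀ u v → u ≢ v → Adj G u v ⊎ (∃[ w ] (Adj G u w × Adj G w v))) ×
  (∃[ u ] ∃[ v ] (u ≢ v × ¬ Adj G u v))

IsSRG : ∀ {n} → Graph n → Set
IsSRG G = ∃[ k ] ∃[ l ] ∃[ m ]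
  (Regular G k ×
   (∀ u v → Adj G u v → common G u v ≡ l) ×
   (∀ u v → u ≢ v → ¬ Adj G u v → common G u v ≡ m))

IsStrictlyDeza : ∀ {n} → Graph n → ℕ → ℕ → ℕ → Set
IsStrictlyDeza G k b a = IsDeza G k b a × HasDiameter2 G × ¬ IsSRG G

InB : ∀ {n} → Graph n → ℕ → Fin n → Fin n → Set
InB G b v u = u ≢ v × common G u v ≡ b

InB[] : ∀ {n} → Graph n → ℕ → Fin n → Fin n → Set
InB[] G b v u = (u ≡ v) ⊎ InB G b v u

betaAt : ∀ {n} → Graph n → ℕ → Fin n → ℕ
betaAt {n} G b v =
  length (filter (λ u → Data.Bool.T? (Data.Bool.not (Data.Fin.toℕ u Data.Nat.≡ᵇ Data.Fin.toℕ v) ∧ (common G u v Data.Nat.≡ᵇ b))) (allFin n))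

TypeA : ∀ {n} → Graph n → ℕ → Fin n → Set
TypeA G b v = ∀ u → InB G b v u → ¬ Adj G v u

module Submission where

-- Since k = b + 1, two vertices with b common neighbours differ in exactly one neighbour on
-- each side.  For x of type (A) and y ∈ B(x) (so x ≁ y) let N(x) ∖ N(y) = {p}; then
-- |N(u) ∩ N(y)| ≥ |N(u) ∩ N(x)| − 1 for every u.  If b ≥ a + 2, having b common neighbours
-- is therefore transitive, which gives B[x] = B[y].  A neighbour of y in B(y) would then lie in
-- B(x) unless it is the private neighbour w of y; counting common neighbours shows that every vertex of
-- N(x) ∩ N(y) is adjacent to w and then to p, so p ∈ B(x) ∩ N(x), against type (A).
-- If b = a + 1, the same counting shows that p has no neighbour in N(x) ∩ N(y), so a = 0
-- and Γ is a triangle-free 2-regular graph of diameter 2, hence strongly regular; if b = a,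
-- Γ is strongly regular outright.

open import Defs
open import Data.Nat using (ℕ; suc; _+_; _≤_; _<_; z≤n; s≤s)
open import Data.Nat.Properties
open import Data.Bool using (Bool; true; false; _∧_; not)
import Data.Bool as Bool
open import Data.Bool.Properties using (¬-not; ∧-comm)
open import Data.Fin using (Fin)
import Data.Fin.Properties as Fin
open import Data.List using (List; []; _∷_; length; filter; allFin)
open import Data.List.Membership.Propositional using (_∈_)
open import Data.List.Membership.Propositional.Properties using (∈-allFin)
open import Data.List.Relation.Unary.Any using (here; there)
open import Data.Product using (_×_; _,_; ∃; proj₁; proj₂)
open import Data.Sum using (_⊎_; inj₁; inj₂; reduce)
import Data.Sum as Sum
open import Data.Empty using (⊥; ⊥-elim)
open import Relation.Nullary using (¬_; yes; no)
open import Relation.Nullary.Decidable using (⌊_⌋)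
open import Relation.Binary.PropositionalEquality hiding (sym)
open import Relation.Binary.PropositionalEquality using () renaming (sym to ≡-sym)
open import Function using (_⇔_; mk⇔; _∘_)

≡true⇒≢false : ∀ {x} → x ≡ true → x ≢ false
≡true⇒≢false refl ()

∧-true⁻ : ∀ {x y} → x ∧ y ≡ true → x ≡ true × y ≡ true
∧-true⁻ {true} {true} _ = refl , refl

∧∧-true⁻ : ∀ {x y z} → (x ∧ y) ∧ z ≡ true → x ≡ true × y ≡ true × z ≡ true
∧∧-true⁻ {true} {true} {true} _ = refl , refl , refl

∧-true⁺ : ∀ {x y} → x ≡ true → y ≡ true → x ∧ y ≡ true
∧-true⁺ refl refl = refl

∧-falseˡ : ∀ {x} y → x ≡ false → x ∧ y ≡ false
∧-falseˡ y refl = refl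

∧-falseʳ : ∀ x {y} → y ≡ false → x ∧ y ≡ false
∧-falseʳ true  refl = refl
∧-falseʳ false refl = refl

not-true⁺ : ∀ {x} → x ≡ false → not x ≡ true
not-true⁺ refl = refl

not-true⁻ : ∀ {x} → not x ≡ true → x ≡ false
not-true⁻ {false} _ = refl

module _ {A : Set} where

  infixl 7 _∩_ _∖_
  infix 4 _⊆_

  _∩_ : (A → Bool) → (A → Bool) → A → Bool
  (f ∩ g) w = f w ∧ g w

  ∁ : (A → Bool) → A → Bool
  ∁ f w = not (f w)

  _∖_ : (A → Bool) → (A → Bool) → A → Bool
  f ∖ g = f ∩ ∁ g

  _⊆_ : (A → Bool) → (A → Bool) → Set
  f ⊆ g = ∀ {w} → f w ≡ true → g w ≡ true

  ∩-⊆ˡ : ∀ f g → f ∩ g ⊆ f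
  ∩-⊆ˡ f g fgw = proj₁ (∧-true⁻ fgw)

  ∩-drop-first : ∀ h f g → h ∩ f ∩ g ⊆ f ∩ g
  ∩-drop-first h f g {w} hfgw with ∧-true⁻ {h w ∧ f w} hfgw
  ... | hfw , gw = ∧-true⁺ (proj₂ (∧-true⁻ {h w} hfw)) gw

  ∩-drop-middle : ∀ h f g → h ∩ f ∩ g ⊆ h ∩ g
  ∩-drop-middle h f g {w} hfgw with ∧-true⁻ {h w ∧ f w} hfgw
  ... | hfw , gw = ∧-true⁺ (proj₁ (∧-true⁻ {h w} hfw)) gw

  count : (A → Bool) → List A → ℕ
  count f xs = length (filter (λ w → f w Bool.≟ true) xs)

  count-cong : ∀ {f g} → (∀ w → f w ≡ g w) → ∀ xs → count f xs ≡ count g xs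
  count-cong f≗g [] = refl
  count-cong {g = g} f≗g (x ∷ xs) rewrite f≗g x with g x
  ... | true  = cong suc (count-cong f≗g xs)
  ... | false = count-cong f≗g xs

  count-none : ∀ {f} → (∀ w → f w ≢ true) → ∀ xs → count f xs ≡ 0
  count-none {f} none xs = trans (count-cong (λ w → ¬-not (none w)) xs) (count-false xs)
    where
      count-false : ∀ xs → count (λ _ → false) xs ≡ 0
      count-false []       = refl
      count-false (_ ∷ xs) = count-false xs

  count-pos : ∀ {f w xs} → w ∈ xs → f w ≡ true → 0 < count f xs
  count-pos {f} {xs = x ∷ xs} (here refl) fw rewrite fw = s≤s z≤n
  count-pos {f} {xs = x ∷ xs} (there w∈xs) fw with f x
  ... | true  = s≤s z≤n
  ... | false = count-pos w∈xs fw

  count-witness : ∀ {f} xs → 0 < count f xs → ∃ λ w → f w ≡ true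
  count-witness {f} (x ∷ xs) pos with f x in fx
  ... | true  = x , fx
  ... | false = count-witness xs pos

  count-∩-∖ : ∀ f g xs → count f xs ≡ count (f ∩ g) xs + count (f ∖ g) xs
  count-∩-∖ f g [] = refl
  count-∩-∖ f g (x ∷ xs) with f x | g x
  ... | true  | true  = cong suc (count-∩-∖ f g xs)
  ... | true  | false = trans (cong suc (count-∩-∖ f g xs)) (≡-sym (+-suc _ _))
  ... | false | _     = count-∩-∖ f g xs

  count-⊆ : ∀ {f g} → f ⊆ g → ∀ xs → count g xs ≡ count f xs + count (g ∖ f) xs
  count-⊆ {f} {g} f⊆g xs =
    trans (count-∩-∖ g f xs) (cong (_+ count (g ∖ f) xs) (count-cong g∩f≗f xs))
    where
      g∩f≗f : ∀ w → (g ∩ f) w ≡ f w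
      g∩f≗f w with f w in fw
      ... | true  = cong (_∧ true) (f⊆g fw)
      ... | false = ∧-falseʳ (g w) refl

  count-mono : ∀ {f g} → f ⊆ g → ∀ xs → count f xs ≤ count g xs
  count-mono f⊆g xs = subst (_ ≤_) (≡-sym (count-⊆ f⊆g xs)) (m≤m+n _ _)

  count-mono-< : ∀ {f g w xs} → f ⊆ g → w ∈ xs → g w ≡ true → f w ≡ false →
                 count f xs < count g xs
  count-mono-< {f} {g} {w} {xs} f⊆g w∈xs gw fw =
    subst₂ _<_ (+-identityʳ (count f xs)) (≡-sym (count-⊆ f⊆g xs))
      (+-monoʳ-< (count f xs) (count-pos w∈xs (∧-true⁺ gw (not-true⁺ fw))))

  count-∩-≤ : ∀ h f g xs → count (h ∩ f) xs ≤ count (h ∩ g) xs + count (f ∖ g) xs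
  count-∩-≤ h f g xs = begin
      count (h ∩ f) xs                             ≡⟨ count-∩-∖ (h ∩ f) g xs ⟩
      count (h ∩ f ∩ g) xs + count (h ∩ f ∖ g) xs   ≤⟨ +-mono-≤ (count-mono (∩-drop-middle h f g) xs) (count-mono (∩-drop-first h f (∁ g)) xs) ⟩
      count (h ∩ g) xs + count (f ∖ g) xs          ∎
    where open ≤-Reasoning

module _ {n : ℕ} where

  ∣_∣ : (Fin n → Bool) → ℕ
  ∣ f ∣ = count f (allFin n)

  ∣∣-pos : ∀ {f} w → f w ≡ true → 0 < ∣ f ∣
  ∣∣-pos w = count-pos (∈-allFin w)

  ∣∣-mono : ∀ {f g} → f ⊆ g → ∣ f ∣ ≤ ∣ g ∣
  ∣∣-mono f⊆g = count-mono f⊆g (allFin n)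

  ∣∣-mono-< : ∀ {f g} w → f ⊆ g → g w ≡ true → f w ≡ false → ∣ f ∣ < ∣ g ∣
  ∣∣-mono-< w f⊆g = count-mono-< f⊆g (∈-allFin w)

  ∣∣-⊆-singleton : ∀ {f g} e → ∣ g ∣ ≡ 1 → f ⊆ g → g e ≡ true → f e ≡ false → ∣ f ∣ ≡ 0
  ∣∣-⊆-singleton e ∣g∣≡1 f⊆g ge fe = n<1⇒n≡0 (subst (_ <_) ∣g∣≡1 (∣∣-mono-< e f⊆g ge fe))

  ∣∣-∖-empty : ∀ f g → ∣ f ∖ g ∣ ≡ 0 → ∣ f ∣ ≡ ∣ f ∩ g ∣
  ∣∣-∖-empty f g ∣f∖g∣≡0 =
    trans (count-∩-∖ f g (allFin n)) (trans (cong (∣ f ∩ g ∣ +_) ∣f∖g∣≡0) (+-identityʳ ∣ f ∩ g ∣))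

  ∣∣-∩-inside : ∀ h f g e → ∣ f ∖ g ∣ ≡ 1 → (f ∖ g) e ≡ true → h e ≡ false →
                ∣ h ∩ f ∣ ≡ ∣ h ∩ f ∩ g ∣
  ∣∣-∩-inside h f g e ∣f∖g∣≡1 f∖g-e he = ∣∣-∖-empty (h ∩ f) g
    (∣∣-⊆-singleton e ∣f∖g∣≡1 (∩-drop-first h f (∁ g)) f∖g-e (∧-falseˡ _ (∧-falseˡ _ he)))

  except : Fin n → Fin n → Bool
  except e w = not ⌊ w Fin.≟ e ⌋

  except-self : ∀ e → except e e ≡ false
  except-self e with e Fin.≟ e
  ... | yes _   = refl
  ... | no e≢e = ⊥-elim (e≢e refl)

  except-≢ : ∀ {e w} → w ≢ e → except e w ≡ true
  except-≢ {e} {w} w≢e with w Fin.≟ e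
  ... | yes w≡e = ⊥-elim (w≢e w≡e)
  ... | no _    = refl

  ∣∣-except-< : ∀ f e → f e ≡ true → ∣ f ∩ except e ∣ < ∣ f ∣
  ∣∣-except-< f e fe = ∣∣-mono-< e (∩-⊆ˡ f (except e)) fe (∧-falseʳ (f e) (except-self e))

  ∣∣≤2-covered : ∀ f {u v w} → ∣ f ∣ ≤ 2 → f u ≡ true → f v ≡ true → u ≢ v →
                 f w ≡ true → w ≡ u ⊎ w ≡ v
  ∣∣≤2-covered f {u} {v} {w} ∣f∣≤2 fu fv u≢v fw with w Fin.≟ u | w Fin.≟ v
  ... | yes w≡u | _       = inj₁ w≡u
  ... | no _    | yes w≡v = inj₂ w≡v
  ... | no w≢u  | no w≢v  =
    ⊥-elim (≤⇒≯ ∣f∣≤2 (≤-trans (s≤s (≤-trans (s≤s (≤-trans (s≤s z≤n) drop-w)) drop-v)) drop-u))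
    where
      f₁ f₂ : Fin n → Bool
      f₁ = f ∩ except u
      f₂ = f₁ ∩ except v
      drop-u : ∣ f₁ ∣ < ∣ f ∣
      drop-u = ∣∣-except-< f u fu
      drop-v : ∣ f₂ ∣ < ∣ f₁ ∣
      drop-v = ∣∣-except-< f₁ v (∧-true⁺ fv (except-≢ (u≢v ∘ ≡-sym)))
      drop-w : ∣ f₂ ∩ except w ∣ < ∣ f₂ ∣
      drop-w = ∣∣-except-< f₂ w (∧-true⁺ (∧-true⁺ fw (except-≢ w≢u)) (except-≢ w≢v))

DezaCounts : ∀ {n} → Graph n → ℕ → ℕ → Set
DezaCounts G b a = ∀ u v → u ≢ v → common G u v ≡ b ⊎ common G u v ≡ a

module _ {n} (G : Graph n) where

  N : Fin n → Fin n → Bool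
  N = adj G

  adj-sym : ∀ {u v} → N u v ≡ true → N v u ≡ true
  adj-sym {u} {v} uv = trans (Graph.sym G v u) uv

  adj⇒≢ : ∀ {u v} → N u v ≡ true → u ≢ v
  adj⇒≢ {u} uv refl = ≡true⇒≢false uv (irref G u)

  common-sym : ∀ u v → common G u v ≡ common G v u
  common-sym u v = count-cong (λ w → ∧-comm (N u w) (N v w)) (allFin n)

  InB-sym : ∀ {b x y} → InB G b x y → InB G b y x
  InB-sym {x = x} {y} (y≢x , c) = (y≢x ∘ ≡-sym) , trans (common-sym x y) c

  common≤common+∣N∖N∣ : ∀ u x y → common G u x ≤ common G u y + ∣ N x ∖ N y ∣
  common≤common+∣N∖N∣ u x y = count-∩-≤ (N u) (N x) (N y) (allFin n)

  common+∣N∖N∣≡degree : ∀ x y → common G x y + ∣ N x ∖ N y ∣ ≡ degree G x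
  common+∣N∖N∣≡degree x y = ≡-sym (count-∩-∖ (N x) (N y) (allFin n))

  ∣N∖N∣≡1 : ∀ {b x y} → Regular G (suc b) → common G x y ≡ b → ∣ N x ∖ N y ∣ ≡ 1
  ∣N∖N∣≡1 {b} {x} {y} regular c = +-cancelˡ-≡ b _ 1 (begin
    b + ∣ N x ∖ N y ∣            ≡⟨ cong (_+ ∣ N x ∖ N y ∣) (≡-sym c) ⟩
    common G x y + ∣ N x ∖ N y ∣ ≡⟨ common+∣N∖N∣≡degree x y ⟩
    degree G x                   ≡⟨ regular x ⟩
    suc b                        ≡⟨ +-comm 1 b ⟩
    b + 1                        ∎)
    where open ≡-Reasoning

  uniform-Deza⇒SRG : ∀ {k b} → Regular G k → DezaCounts G b b → IsSRG G
  uniform-Deza⇒SRG {k} {b} regular deza =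
    k , b , b , regular , (λ u v uv → reduce (deza u v (adj⇒≢ uv))) , (λ u v u≢v _ → reduce (deza u v u≢v))

  module _ {b a} (deza : DezaCounts G b a) where

    a≤common : a ≤ b → ∀ {u v} → u ≢ v → a ≤ common G u v
    a≤common a≤b {u} {v} u≢v with deza u v u≢v
    ... | inj₁ c≡b = subst (a ≤_) (≡-sym c≡b) a≤b
    ... | inj₂ c≡a = ≤-reflexive (≡-sym c≡a)

    above-a⇒≡b : ∀ {u v} → u ≢ v → a < common G u v → common G u v ≡ b
    above-a⇒≡b {u} {v} u≢v a<c with deza u v u≢v
    ... | inj₁ c≡b = c≡b
    ... | inj₂ c≡a = ⊥-elim (<-irrefl (≡-sym c≡a) a<c)

    module _ (regular : Regular G (suc b)) (a+2≤b : suc (suc a) ≤ b) where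

      common≡b-trans : ∀ {u x y} → common G x y ≡ b → common G u x ≡ b → u ≢ y → common G u y ≡ b
      common≡b-trans {u} {x} {y} cxy cux u≢y = above-a⇒≡b u≢y (≤-pred (≤-trans a+2≤b (begin
        b                                ≡⟨ ≡-sym cux ⟩
        common G u x                     ≤⟨ common≤common+∣N∖N∣ u x y ⟩
        common G u y + ∣ N x ∖ N y ∣     ≡⟨ cong (common G u y +_) (∣N∖N∣≡1 regular cxy) ⟩
        common G u y + 1                 ≡⟨ +-comm (common G u y) 1 ⟩
        suc (common G u y)               ∎)))
        where open ≤-Reasoning

      B[]-⊆ : ∀ {x y} → InB G b x y → ∀ {u} → InB[] G b x u → InB[] G b y u
      B[]-⊆ y∈Bx (inj₁ refl) = inj₂ (InB-sym y∈Bx)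
      B[]-⊆ {x} {y} (y≢x , cyx) {u} (inj₂ (u≢x , cux)) with u Fin.≟ y
      ... | yes u≡y = inj₁ u≡y
      ... | no u≢y  = inj₂ (u≢y , common≡b-trans (trans (common-sym x y) cyx) cux u≢y)

  module _ (regular : Regular G 2) (deza : DezaCounts G 1 0) (diameter2 : HasDiameter2 G) where

    neighbours-of-2-regular : ∀ {u v w z} → N u v ≡ true → N u w ≡ true → v ≢ w → N u z ≡ true →
                              z ≡ v ⊎ z ≡ w
    neighbours-of-2-regular {u} = ∣∣≤2-covered (N u) (≤-reflexive (regular u))

    module _ {u v w} (u~v : N u v ≡ true) (u~w : N u w ≡ true) (v~w : N v w ≡ true) where

      triangle-spans : ∀ c → c ≡ u ⊎ c ≡ v ⊎ c ≡ w
      triangle-spans c with c Fin.≟ u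
      ... | yes c≡u = inj₁ c≡u
      ... | no c≢u with proj₁ diameter2 u c (c≢u ∘ ≡-sym)
      ...   | inj₁ u~c = inj₂ (neighbours-of-2-regular u~v u~w (adj⇒≢ v~w) u~c)
      ...   | inj₂ (z , u~z , z~c) with neighbours-of-2-regular u~v u~w (adj⇒≢ v~w) u~z
      ...     | inj₁ refl = Sum.map₂ inj₂ (neighbours-of-2-regular (adj-sym u~v) v~w (adj⇒≢ u~w) z~c)
      ...     | inj₂ refl = Sum.map₂ inj₁ (neighbours-of-2-regular (adj-sym u~w) (adj-sym v~w) (adj⇒≢ u~v) z~c)

      triangle-clique : ∀ {c d} → c ≡ u ⊎ c ≡ v ⊎ c ≡ w → d ≡ u ⊎ d ≡ v ⊎ d ≡ w → c ≢ d → N c d ≡ true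
      triangle-clique (inj₁ refl)        (inj₁ refl)        c≢d = ⊥-elim (c≢d refl)
      triangle-clique (inj₁ refl)        (inj₂ (inj₁ refl)) _   = u~v
      triangle-clique (inj₁ refl)        (inj₂ (inj₂ refl)) _   = u~w
      triangle-clique (inj₂ (inj₁ refl)) (inj₁ refl)        _   = adj-sym u~v
      triangle-clique (inj₂ (inj₁ refl)) (inj₂ (inj₁ refl)) c≢d = ⊥-elim (c≢d refl)
      triangle-clique (inj₂ (inj₁ refl)) (inj₂ (inj₂ refl)) _   = v~w
      triangle-clique (inj₂ (inj₂ refl)) (inj₁ refl)        _   = adj-sym u~w
      triangle-clique (inj₂ (inj₂ refl)) (inj₂ (inj₁ refl)) _   = adj-sym v~w
      triangle-clique (inj₂ (inj₂ refl)) (inj₂ (inj₂ refl)) c≢d = ⊥-elim (c≢d refl)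

      triangle-impossible : ⊥
      triangle-impossible with proj₂ diameter2
      ... | c , d , c≢d , c≁d = c≁d (triangle-clique (triangle-spans c) (triangle-spans d) c≢d)

    2-regular-Deza⇒SRG : IsSRG G
    2-regular-Deza⇒SRG = 2 , 0 , 1 , regular , adjacent , non-adjacent
      where
        adjacent : ∀ u v → Adj G u v → common G u v ≡ 0
        adjacent u v u~v with deza u v (adj⇒≢ u~v)
        ... | inj₂ c≡0 = c≡0
        ... | inj₁ c≡1 with count-witness (allFin n) (subst (0 <_) (≡-sym c≡1) (s≤s z≤n))
        ...   | w , uvw = ⊥-elim (triangle-impossible u~v (proj₁ (∧-true⁻ uvw)) (proj₂ (∧-true⁻ {N u w} uvw)))
        non-adjacent : ∀ u v → u ≢ v → ¬ Adj G u v → common G u v ≡ 1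
        non-adjacent u v u≢v u≁v with proj₁ diameter2 u v u≢v
        ... | inj₁ u~v = ⊥-elim (u≁v u~v)
        ... | inj₂ (w , u~w , w~v) = above-a⇒≡b deza u≢v (∣∣-pos w (∧-true⁺ u~w (adj-sym w~v)))

  module TypeAPair {b a} (regular : Regular G (suc b)) (deza : DezaCounts G b a)
                   {x y} (x-typeA : TypeA G b x) (y∈Bx : InB G b x y) where

    common-xy : common G x y ≡ b
    common-xy = proj₂ (InB-sym y∈Bx)

    x≁y : N x y ≡ false
    x≁y with N x y in xy
    ... | true  = ⊥-elim (x-typeA y y∈Bx xy)
    ... | false = refl

    y≁x : N y x ≡ false
    y≁x = trans (Graph.sym G y x) x≁y

    ∣Nx∖Ny∣≡1 : ∣ N x ∖ N y ∣ ≡ 1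
    ∣Nx∖Ny∣≡1 = ∣N∖N∣≡1 regular common-xy

    ∣Ny∖Nx∣≡1 : ∣ N y ∖ N x ∣ ≡ 1
    ∣Ny∖Nx∣≡1 = ∣N∖N∣≡1 regular (proj₂ y∈Bx)

    common-with-x : ∀ {z} → N x z ≡ true → common G z x ≡ a
    common-with-x {z} xz with deza z x (adj⇒≢ xz ∘ ≡-sym)
    ... | inj₁ c≡b = ⊥-elim (x-typeA z ((adj⇒≢ xz ∘ ≡-sym) , c≡b) xz)
    ... | inj₂ c≡a = c≡a

    private-neighbour : ∃ λ p → (N x ∖ N y) p ≡ true
    private-neighbour = count-witness (allFin n) (subst (0 <_) (≡-sym ∣Nx∖Ny∣≡1) (s≤s z≤n))

    p : Fin n
    p = proj₁ private-neighbour

    x~p : N x p ≡ true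
    x~p = proj₁ (∧-true⁻ (proj₂ private-neighbour))

    y≁p : N y p ≡ false
    y≁p = not-true⁻ (proj₂ (∧-true⁻ {N x p} (proj₂ private-neighbour)))

    module _ (a+2≤b : suc (suc a) ≤ b) where

      B[x]⇔B[y] : ∀ u → InB[] G b x u ⇔ InB[] G b y u
      B[x]⇔B[y] u = mk⇔ (B[]-⊆ deza regular a+2≤b y∈Bx) (B[]-⊆ deza regular a+2≤b (InB-sym y∈Bx))

      module _ {w} (y~w : N y w ≡ true) (x≁w : N x w ≡ false) (cyw : common G y w ≡ b) where

        common-neighbours⊆Nw : N x ∩ N y ⊆ N w
        common-neighbours⊆Nw {z} xyz with N w z in wz
        ... | true  = refl
        ... | false = ⊥-elim (<-irrefl cyw (begin-strict
          common G y w                   ≡⟨ common-sym y w ⟩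
          ∣ N w ∩ N y ∣                  ≡⟨ ∣∣-∩-inside (N w) (N y) (N x) w ∣Ny∖Nx∣≡1
                                              (∧-true⁺ y~w (not-true⁺ x≁w)) (irref G w) ⟩
          ∣ N w ∩ N y ∩ N x ∣            <⟨ ∣∣-mono-< z (∩-drop-first (N w) (N y) (N x))
                                              (∧-true⁺ y~z x~z) (∧-falseˡ _ (∧-falseˡ _ wz)) ⟩
          common G y x                   ≡⟨ proj₂ y∈Bx ⟩
          b                              ∎))
          where
            open ≤-Reasoning
            x~z : N x z ≡ true
            x~z = proj₁ (∧-true⁻ {N x z} xyz)
            y~z : N y z ≡ true
            y~z = proj₂ (∧-true⁻ {N x z} xyz)

        common-neighbours⊆Np : N x ∩ N y ⊆ N p
        common-neighbours⊆Np {z} xyz with N p z in pz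
        ... | true  = refl
        ... | false = ⊥-elim (<⇒≢ czy<b (above-a⇒≡b deza (adj⇒≢ (adj-sym y~z)) a<czy))
          where
            open ≤-Reasoning
            x~z : N x z ≡ true
            x~z = proj₁ (∧-true⁻ {N x z} xyz)
            y~z : N y z ≡ true
            y~z = proj₂ (∧-true⁻ {N x z} xyz)
            a<czy : a < common G z y
            a<czy = begin-strict
              a                        ≡⟨ ≡-sym (common-with-x x~z) ⟩
              common G z x             ≡⟨ ∣∣-∩-inside (N z) (N x) (N y) p ∣Nx∖Ny∣≡1
                                            (proj₂ private-neighbour) (trans (Graph.sym G z p) pz) ⟩
              ∣ N z ∩ N x ∩ N y ∣      <⟨ ∣∣-mono-< w (∩-drop-middle (N z) (N x) (N y))
                                            (∧-true⁺ (adj-sym (common-neighbours⊆Nw xyz)) y~w)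
                                            (∧-falseˡ (N y w) (∧-falseʳ (N z w) x≁w)) ⟩
              common G z y             ∎
            czy<b : common G z y < b
            czy<b = begin-strict
              common G z y                   ≤⟨ common≤common+∣N∖N∣ z y x ⟩
              common G z x + ∣ N y ∖ N x ∣   ≡⟨ cong₂ _+_ (common-with-x x~z) ∣Ny∖Nx∣≡1 ⟩
              a + 1                          ≡⟨ +-comm a 1 ⟩
              suc a                          <⟨ a+2≤b ⟩
              b                              ∎

        p∈Bx : InB G b x p
        p∈Bx = (x≢p ∘ ≡-sym) , trans (common-sym p x) (above-a⇒≡b deza x≢p (<-≤-trans a<b b≤cxp))
          where
            x≢p : x ≢ p
            x≢p = adj⇒≢ x~p
            a<b : a < b
            a<b = ≤-trans (n≤1+n (suc a)) a+2≤b
            b≤cxp : b ≤ common G x p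
            b≤cxp = subst (_≤ common G x p) common-xy (∣∣-mono (λ {z} xyz →
              ∧-true⁺ (proj₁ (∧-true⁻ {N x z} xyz)) (common-neighbours⊆Np xyz)))

      y-typeA : TypeA G b y
      y-typeA u (u≢y , cuy) y~u with N x u in xu
      ... | true  = x-typeA u (u≢x , common≡b-trans deza regular a+2≤b (proj₂ y∈Bx) cuy u≢x) xu
        where
          u≢x : u ≢ x
          u≢x = adj⇒≢ xu ∘ ≡-sym
      ... | false = x-typeA p (p∈Bx y~u xu (trans (common-sym y u) cuy)) x~p

    module _ (b≡1+a : b ≡ suc a) where

      common-neighbour≁p : ∀ {z} → N x z ≡ true → N y z ≡ true → N p z ≢ true
      common-neighbour≁p {z} x~z y~z p~z = <⇒≱ czy<a (a≤common deza a≤b (adj⇒≢ (adj-sym y~z)))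
        where
          open ≤-Reasoning
          a≤b : a ≤ b
          a≤b = subst (a ≤_) (≡-sym b≡1+a) (n≤1+n a)
          ∣Nz∖Nx∣≡2 : ∣ N z ∖ N x ∣ ≡ 2
          ∣Nz∖Nx∣≡2 = +-cancelˡ-≡ a _ 2 (begin-equality
            a + ∣ N z ∖ N x ∣             ≡⟨ cong (_+ ∣ N z ∖ N x ∣) (≡-sym (common-with-x x~z)) ⟩
            common G z x + ∣ N z ∖ N x ∣  ≡⟨ common+∣N∖N∣≡degree z x ⟩
            degree G z                    ≡⟨ regular z ⟩
            suc b                         ≡⟨ cong suc b≡1+a ⟩
            2 + a                         ≡⟨ +-comm 2 a ⟩
            a + 2                         ∎)
          -- N(z) ∖ N(x) = {x, y}, and neither x nor y is adjacent to y
          outside-Nx-empty : ∀ v → (N z ∩ N y ∖ N x) v ≢ true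
          outside-Nx-empty v zyv with ∧∧-true⁻ {N z v} zyv
          ... | z~v , y~v , x≁v with ∣∣≤2-covered (N z ∖ N x) {w = v} (≤-reflexive ∣Nz∖Nx∣≡2)
                                       (∧-true⁺ (adj-sym x~z) (not-true⁺ (irref G x)))
                                       (∧-true⁺ (adj-sym y~z) (not-true⁺ x≁y))
                                       (proj₁ y∈Bx ∘ ≡-sym) (∧-true⁺ z~v x≁v)
          ...   | inj₁ refl = ≡true⇒≢false y~v y≁x
          ...   | inj₂ refl = ≡true⇒≢false y~v (irref G y)
          czy<a : common G z y < a
          czy<a = begin-strict
            common G z y             ≡⟨ ∣∣-∖-empty (N z ∩ N y) (N x) (count-none outside-Nx-empty (allFin n)) ⟩
            ∣ N z ∩ N y ∩ N x ∣      <⟨ ∣∣-mono-< p (∩-drop-middle (N z) (N y) (N x))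
                                          (∧-true⁺ (adj-sym p~z) x~p) (∧-falseˡ (N x p) (∧-falseʳ (N z p) y≁p)) ⟩
            common G z x             ≡⟨ common-with-x x~z ⟩
            a                        ∎

      a≡0 : a ≡ 0
      a≡0 = begin
        a                        ≡⟨ ≡-sym (common-with-x x~p) ⟩
        common G p x             ≡⟨ ∣∣-∩-inside (N p) (N x) (N y) p ∣Nx∖Ny∣≡1
                                      (proj₂ private-neighbour) (irref G p) ⟩
        ∣ N p ∩ N x ∩ N y ∣      ≡⟨ count-none p-misses (allFin n) ⟩
        0                        ∎
        where
          open ≡-Reasoning
          p-misses : ∀ z → (N p ∩ N x ∩ N y) z ≢ true
          p-misses z pxyz with ∧∧-true⁻ {N p z} pxyz
          ... | p~z , x~z , y~z = common-neighbour≁p x~z y~z p~z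

lemma7 : ∀ {n} (G : Graph n) (k b a : ℕ) → IsStrictlyDeza G k b a → k ≡ suc b
    → (∀ v → 1 < betaAt G b v)
    → ∀ x → TypeA G b x → ∀ xi → InB G b x xi
    → (∀ u → InB[] G b x u ⇔ InB[] G b xi u) × TypeA G b xi
lemma7 G _ b a ((_ , a≤b , regular , deza) , diameter2 , ¬srg) refl _ x x-typeA y y∈Bx
  with m≤n⇒m<n∨m≡n a≤b
... | inj₂ refl = ⊥-elim (¬srg (uniform-Deza⇒SRG G regular deza))
... | inj₁ a<b with m≤n⇒m<n∨m≡n a<b
...   | inj₁ a+2≤b = B[x]⇔B[y] a+2≤b , y-typeA a+2≤b
  where open TypeAPair G regular deza x-typeA y∈Bx
...   | inj₂ refl with TypeAPair.a≡0 G regular deza x-typeA y∈Bx refl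
...     | refl = ⊥-elim (¬srg (2-regular-Deza⇒SRG G regular deza diameter2))
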